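{- For $\pi\in\mathcal{S}_n$, $\pi$ is irreducible if and only if $\theta(\pi)$ is irreducible.
   Context: $\mathcal{S}_n$ is the symmetric group on $[n]$, permutations in one-line notation. The standard cycle notation of $\pi$ writes each cycle (fixed points included) with its largest element first and orders cycles by increasing largest element. The fundamental bijection $\theta:\mathcal{S}_n\to\mathcal{S}_n$ maps $\pi$ to the permutation whose one-line notation is obtained by erasing the parentheses of the standard cycle notation of $\pi$. The direct sum $\pi\oplus\tau\in\mathcal{S}_{n+m}$ of $\pi\in\mathcal{S}_n,\tau\in\mathcal{S}_m$ is $\pi(i)$ for $i\le n$ and $\tau(i-n)+n$ for $i>n$. A permutation in $\mathcal{S}_n$ is reducible if it equals $\sigma\oplus\tau$ with $\sigma\in\mathcal{S}_{n-k}$, $\tau\in\mathcal{S}_k$, $1\le k\le n-1$, and irreducible otherwise. -}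

module Defs where

open import Data.Nat using (ℕ; zero; suc; _+_; _≤ᵇ_)
open import Data.Fin using (Fin; toℕ; cast; splitAt; _↑ˡ_; _↑ʳ_; _≟_)
open import Data.Fin.Permutation using (Permutation′; _⟨$⟩ʳ_)
open import Data.List using (List; []; _∷_; concatMap; allFin)
open import Data.Bool using (Bool; true; false; if_then_else_)
open import Data.Sum using ([_,_]′)
open import Data.Product using (Σ; _×_)
open import Relation.Nullary using (¬_; does)
open import Relation.Binary.PropositionalEquality using (_≡_; sym)

-- Permutations of [n] are modelled as permutations of Fin n (0-based; the
-- shift by one preserves all order relations used below).

_⊕_ : ∀ {m k} → (Fin m → Fin m) → (Fin k → Fin k) → Fin (m + k) → Fin (m + k)
_⊕_ {m} {k} σ τ i = [ (λ a → σ a ↑ˡ k) , (λ b → m ↑ʳ τ b) ]′ (splitAt m i)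

-- f : Fin n → Fin n is reducible if it equals σ ⊕ τ with σ ∈ S_{n-k},
-- τ ∈ S_k, 1 ≤ k ≤ n-1 (i.e. both blocks of positive size).
Reducible : ∀ {n} → (Fin n → Fin n) → Set
Reducible {n} f =
  Σ ℕ λ m → Σ ℕ λ k → Σ (suc m + suc k ≡ n) λ eq →
  Σ (Permutation′ (suc m)) λ σ → Σ (Permutation′ (suc k)) λ τ →
  ∀ i → f i ≡ cast eq (((σ ⟨$⟩ʳ_) ⊕ (τ ⟨$⟩ʳ_)) (cast (sym eq) i))

Irreducible : ∀ {n} → (Fin n → Fin n) → Set
Irreducible f = ¬ Reducible f

-- Cycle of f through x, listed starting from x: x, f x, f² x, ... (fuel-bounded;
-- fuel n suffices for a permutation of Fin n).
cycleFrom : ∀ {n} → (Fin n → Fin n) → Fin n → Fin n → ℕ → List (Fin n)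
cycleFrom f m x zero = []
cycleFrom f m x (suc fuel) = if does (x ≟ m) then [] else x ∷ cycleFrom f m (f x) fuel

orbit : ∀ {n} → (Fin n → Fin n) → Fin n → List (Fin n)
orbit {n} f m = m ∷ cycleFrom f m (f m) n

isLeader : ∀ {n} → (Fin n → Fin n) → Fin n → Bool
isLeader f m = allB (orbit f m)
  where
  allB : List (Fin _) → Bool
  allB [] = true
  allB (y ∷ ys) = if toℕ y ≤ᵇ toℕ m then allB ys else false

-- Standard cycle notation with parentheses erased: cycles ordered by
-- increasing largest element, each written starting with its largest element.
thetaWord : ∀ {n} → (Fin n → Fin n) → List (Fin n)
thetaWord {n} f = concatMap (λ m → if isLeader f m then orbit f m else []) (allFin n)

nth : ∀ {A : Set} → A → List A → ℕ → A
nth d [] _ = d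
nth d (x ∷ xs) zero = x
nth d (x ∷ xs) (suc i) = nth d xs i

-- θ(π) in one-line notation: position i ↦ i-th letter of thetaWord.
-- (thetaWord has length n for a permutation, so the default is never used.)
θ : ∀ {n} → Permutation′ n → Fin n → Fin n
θ π i = nth i (thetaWord (π ⟨$⟩ʳ_)) (toℕ i)

{-# OPTIONS --safe #-}

-- A permutation π of [n] is reducible iff it splits at some cut 0 < p < n, i.e. i < p ⇔ π i < p
-- for all i. For a permutation this says that every cycle lies entirely below or entirely above
-- the cut, i.e. that every element lies on the same side as the leader (largest element) of its
-- cycle. In θ(π) the cycles appear as consecutive blocks in increasing order of their leaders,
-- each block starting with its leader. If every cycle respects the cut, the blocks with leaders
-- below p come first and consist of exactly the p elements below p, so θ(π) splits at p.
-- Conversely, if θ(π) splits at p, a leader M ≥ p sits at a position ≥ p and the rest of its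
-- block follows it, so its whole cycle lies above the cut.

module Submission where

open import Defs
open import Data.Bool using (Bool; true; false; if_then_else_)
open import Data.Nat using (ℕ; zero; suc; _+_; _∸_; _≤_; _<_; _≤?_; _<?_; z≤n; s≤s; z<s; s<s)
open import Data.Nat.GeneralisedArithmetic using (iterate)
open import Data.Nat.Properties
  using (≤-refl; ≤-antisym; <-≤-trans; ≤-<-trans; <⇒≤; <⇒≱; ≮⇒≥; ≤-pred; n<1+n; m≤m+n; m≤n⇒m<n∨m≡n;
         +-suc; m∸n+n≡m; m+[n∸m]≡n; ∸-monoʳ-<; +-monoʳ-<; +-monoʳ-≤)
open import Data.Fin as Fin using (Fin; toℕ; fromℕ<; inject≤; cast; splitAt; reduce≥; _↑ˡ_; _↑ʳ_)
open import Data.Fin.Properties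
  using (toℕ-injective; toℕ<n; toℕ-fromℕ<; fromℕ<-injective; toℕ-inject; toℕ-inject≤; inject≤-injective; toℕ-cast; cast-is-id;
         ≤-totalOrder; pigeonhole; injective⇒≤; ¬∀⟶∃¬-smallest; toℕ-↑ˡ; toℕ-↑ʳ; ↑ˡ-injective; ↑ʳ-injective;
         splitAt⁻¹-↑ˡ; splitAt⁻¹-↑ʳ; splitAt-<; splitAt-≥)
open import Data.Fin.Permutation using (Permutation′; permutation; _⟨$⟩ʳ_; _⟨$⟩ˡ_; inverseˡ; inverseʳ)
open import Data.List using (List; []; _∷_; _++_; length; lookup; applyUpTo; concatMap; tabulate; allFin)
open import Data.List.Properties using (concatMap-++; length-++; length-++-≤ˡ)
open import Data.List.Membership.Propositional using (_∈_)
open import Data.List.Membership.Propositional.Properties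
  using (∈-lookup; ∈-∃++; ∈-allFin; ∈-tabulate⁺; ∈-tabulate⁻; ∈-applyUpTo⁺; ∈-applyUpTo⁻;
         ∈-concatMap⁺; ∈-concatMap⁻)
open import Data.List.Relation.Binary.Disjoint.Propositional using (Disjoint)
open import Data.List.Relation.Unary.All as All using (All; []; _∷_)
import Data.List.Relation.Unary.All.Properties as All
import Data.List.Relation.Unary.AllPairs as AllPairs
import Data.List.Relation.Unary.AllPairs.Properties as AllPairs
open import Data.List.Relation.Unary.Any as Any using (here; there; index)
open import Data.List.Relation.Unary.Unique.Propositional using (Unique; []; _∷_)
open import Data.List.Relation.Unary.Unique.Propositional.Properties
  using (applyUpTo⁺₁; concat⁺; allFin⁺; tabulate⁺)
open import Data.Product using (∃; ∃₂; _×_; _,_; proj₁; proj₂)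
open import Data.Sum using (inj₁; inj₂)
open import Function using (_⇔_; mk⇔; Equivalence; Injection; Injective; _∘_; id)
open import Function.Construct.Identity using (⇔-id)
open import Function.Construct.Symmetry using (⇔-sym)
open import Function.Properties.Equivalence using () renaming (trans to ⇔-trans)
open import Function.Properties.Inverse using (↔⇒↣)
open import Relation.Binary.PropositionalEquality
open import Relation.Nullary using (¬_; ¬?; does; yes; no; contradiction; contraposition)
open import Relation.Nullary.Decidable using (decidable-stable)
open import Relation.Unary using (Decidable)

private variable
  A : Set
  n p : ℕ

module _ (d : A) where

  nth-++ˡ : ∀ (xs ys : List A) {i} → i < length xs → nth d (xs ++ ys) i ≡ nth d xs i
  nth-++ˡ (x ∷ xs) ys {zero}  _       = refl
  nth-++ˡ (x ∷ xs) ys {suc i} (s≤s i<) = nth-++ˡ xs ys i<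

  nth-++ʳ : ∀ (xs ys : List A) j → nth d (xs ++ ys) (length xs + j) ≡ nth d ys j
  nth-++ʳ []       ys j = refl
  nth-++ʳ (x ∷ xs) ys j = nth-++ʳ xs ys j

  nth-index : ∀ {xs : List A} {y} (y∈xs : y ∈ xs) → nth d xs (toℕ (index y∈xs)) ≡ y
  nth-index (here refl) = refl
  nth-index (there y∈xs) = nth-index y∈xs

  nth-lookup : ∀ (xs : List A) k → nth d xs (toℕ k) ≡ lookup xs k
  nth-lookup (x ∷ xs) Fin.zero    = refl
  nth-lookup (x ∷ xs) (Fin.suc k) = nth-lookup xs k

  All-nth : ∀ {P : A → Set} {xs} → All P xs → P d → ∀ i → P (nth d xs i)
  All-nth []         Pd _       = Pd
  All-nth (Px ∷ _)   Pd zero    = Px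
  All-nth (_ ∷ Pxs)  Pd (suc i) = All-nth Pxs Pd i

  nth-∈ : ∀ (xs : List A) {i} → i < length xs → nth d xs i ∈ xs
  nth-∈ (x ∷ xs) {zero}  _        = here refl
  nth-∈ (x ∷ xs) {suc i} (s≤s i<) = there (nth-∈ xs i<)

nth-injective : ∀ {xs : List A} → Unique xs → ∀ {d d′ i j} → i < length xs → j < length xs →
                nth d xs i ≡ nth d′ xs j → i ≡ j
nth-injective (_ ∷ _)      {i = zero}  {zero}  _ _ _ = refl
nth-injective (x∉xs ∷ _)   {i = zero}  {suc j} _ (s≤s j<) x≡ =
  contradiction x≡ (All.lookup x∉xs (nth-∈ _ _ j<))
nth-injective (x∉xs ∷ _)   {i = suc i} {zero}  (s≤s i<) _ ≡x =
  contradiction (sym ≡x) (All.lookup x∉xs (nth-∈ _ _ i<))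
nth-injective (_ ∷ uniq)   {i = suc i} {suc j} (s≤s i<) (s≤s j<) eq =
  cong suc (nth-injective uniq i< j< eq)

length-unique-below : p ≤ n → ∀ {xs : List (Fin n)} → Unique xs → (∀ y → y ∈ xs ⇔ toℕ y < p) →
                      length xs ≡ p
length-unique-below {p} {n} p≤n {xs} uniq ∈⇔ =
  ≤-antisym (injective⇒≤ below-injective) (injective⇒≤ position-injective)
  where
  below : Fin (length xs) → Fin p
  below k = fromℕ< (Equivalence.to (∈⇔ _) (∈-lookup k))

  below-injective : Injective _≡_ _≡_ below
  below-injective {k} {l} eq = toℕ-injective (nth-injective uniq (toℕ<n k) (toℕ<n l) (begin
    nth (lookup xs k) xs (toℕ k) ≡⟨ nth-lookup _ xs k ⟩
    lookup xs k                  ≡⟨ toℕ-injective (fromℕ<-injective _ _ _ _ eq) ⟩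
    lookup xs l                  ≡⟨ sym (nth-lookup _ xs l) ⟩
    nth (lookup xs k) xs (toℕ l) ∎))
    where open ≡-Reasoning

  member : ∀ i → inject≤ i p≤n ∈ xs
  member i = Equivalence.from (∈⇔ _) (subst (_< p) (sym (toℕ-inject≤ i p≤n)) (toℕ<n i))

  position-injective : Injective _≡_ _≡_ (λ i → index (member i))
  position-injective {i} {j} eq = inject≤-injective p≤n p≤n i j (begin
    inject≤ i p≤n                     ≡⟨ nth-index d (member i) ⟨
    nth d xs (toℕ (index (member i))) ≡⟨ cong (λ k → nth d xs (toℕ k)) eq ⟩
    nth d xs (toℕ (index (member j))) ≡⟨ nth-index d (member j) ⟩
    inject≤ j p≤n                     ∎)
    where
    open ≡-Reasoning
    d = inject≤ i p≤n

module _ {P : A → Set} (P? : Decidable P) where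

  if-∷≡true⇔All : ∀ {b y ys} → (b ≡ true ⇔ All P ys) →
                  (if does (P? y) then b else false) ≡ true ⇔ All P (y ∷ ys)
  if-∷≡true⇔All {y = y} b⇔ with P? y
  ... | yes Py = mk⇔ (λ b≡true → Py ∷ Equivalence.to b⇔ b≡true)
                     (λ { (_ ∷ all) → Equivalence.from b⇔ all })
  ... | no ¬Py = mk⇔ (λ ()) (λ { (Py ∷ _) → contradiction Py ¬Py })

  fold-if≡true⇔All : ∀ {B : List A → Bool} → B [] ≡ true →
                     (∀ y ys → B (y ∷ ys) ≡ (if does (P? y) then B ys else false)) →
                     ∀ xs → B xs ≡ true ⇔ All P xs
  fold-if≡true⇔All B[] B∷ []       = mk⇔ (λ _ → []) (λ _ → B[])
  fold-if≡true⇔All B[] B∷ (y ∷ ys) rewrite B∷ y ys = if-∷≡true⇔All (fold-if≡true⇔All B[] B∷ ys)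

-- Splitting at a cut

↑ˡ-< : ∀ {m} (a : Fin m) k → toℕ (a ↑ˡ k) < m
↑ˡ-< a k = subst (_< _) (sym (toℕ-↑ˡ a k)) (toℕ<n a)

↑ʳ-≥ : ∀ m {k} (b : Fin k) → m ≤ toℕ (m ↑ʳ b)
↑ʳ-≥ m b = subst (m ≤_) (sym (toℕ-↑ʳ m b)) (m≤m+n m (toℕ b))

tabulate-+ : ∀ {p q} (g : Fin (p + q) → A) →
             tabulate g ≡ tabulate (g ∘ (_↑ˡ q)) ++ tabulate (g ∘ (p ↑ʳ_))
tabulate-+ {p = zero}  g = refl
tabulate-+ {p = suc p} {q} g = cong (g Fin.zero ∷_) (tabulate-+ {p = p} {q} (g ∘ Fin.suc))

∈-tabulate-↑ˡ⇔ : ∀ {p q} {z : Fin (p + q)} → z ∈ tabulate (_↑ˡ q) ⇔ toℕ z < p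
∈-tabulate-↑ˡ⇔ {p} {q} {z} = mk⇔ to from
  where
  to : z ∈ tabulate (_↑ˡ q) → toℕ z < p
  to z∈ with ∈-tabulate⁻ z∈
  ... | a , refl = ↑ˡ-< a q
  from : toℕ z < p → z ∈ tabulate (_↑ˡ q)
  from z<p = subst (_∈ _) (splitAt⁻¹-↑ˡ (splitAt-< p z z<p)) (∈-tabulate⁺ (fromℕ< z<p))

∈-tabulate-↑ʳ⇒≥ : ∀ {p q} {z : Fin (p + q)} → z ∈ tabulate (p ↑ʳ_) → p ≤ toℕ z
∈-tabulate-↑ʳ⇒≥ {p} z∈ with ∈-tabulate⁻ z∈
... | b , refl = ↑ʳ-≥ p b

Splits : (Fin n → Fin n) → ℕ → Set
Splits h p = ∀ i → toℕ i < p ⇔ toℕ (h i) < p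

Splits-resp-≗ : ∀ {g h : Fin n → Fin n} → g ≗ h → Splits h p → Splits g p
Splits-resp-≗ {p = p} g≗h s i = subst (λ y → toℕ i < p ⇔ toℕ y < p) (sym (g≗h i)) (s i)

cast-splits : ∀ {m} {h : Fin m → Fin m} (eq : m ≡ n) → Splits h p → Splits (cast eq ∘ h ∘ cast (sym eq)) p
cast-splits {p = p} eq s i =
  subst₂ (λ a b → a < p ⇔ b < p) (toℕ-cast (sym eq) i) (sym (toℕ-cast eq _)) (s (cast (sym eq) i))

inverse-splits : ∀ {g h : Fin n → Fin n} → (∀ y → h (g y) ≡ y) → Splits h p → Splits g p
inverse-splits {p = p} {g} hg s y = ⇔-sym (subst (λ z → toℕ (g y) < p ⇔ toℕ z < p) (hg y) (s (g y)))

prefix-splits : ∀ (xs ys : List (Fin n)) → length xs ≡ p →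
                All (λ y → toℕ y < p) xs → All (λ y → p ≤ toℕ y) ys →
                Splits (λ i → nth i (xs ++ ys) (toℕ i)) p
prefix-splits xs ys refl xs<p ys≥p i = mk⇔ low from
  where
  low : toℕ i < length xs → toℕ (nth i (xs ++ ys) (toℕ i)) < length xs
  low i<p = subst (λ z → toℕ z < length xs) (sym (nth-++ˡ i xs ys i<p)) (All-nth i xs<p i<p (toℕ i))

  high : length xs ≤ toℕ i → length xs ≤ toℕ (nth i (xs ++ ys) (toℕ i))
  high p≤i = subst (λ z → length xs ≤ toℕ z) (sym (begin
    nth i (xs ++ ys) (toℕ i)                           ≡⟨ cong (nth i (xs ++ ys)) (m+[n∸m]≡n p≤i) ⟨
    nth i (xs ++ ys) (length xs + (toℕ i ∸ length xs)) ≡⟨ nth-++ʳ i xs ys _ ⟩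
    nth i ys (toℕ i ∸ length xs)                       ∎)) (All-nth i ys≥p p≤i _)
    where open ≡-Reasoning

  from : toℕ (nth i (xs ++ ys) (toℕ i)) < length xs → toℕ i < length xs
  from hi<p with toℕ i <? length xs
  ... | yes i<p = i<p
  ... | no  i≮p = contradiction (high (≮⇒≥ i≮p)) (<⇒≱ hi<p)

⊕-splits : ∀ {m k} (σ : Fin m → Fin m) (τ : Fin k → Fin k) → Splits (σ ⊕ τ) m
⊕-splits {m} {k} σ τ i with splitAt m i in eq
... | inj₁ a = mk⇔ (λ _ → ↑ˡ-< (σ a) k)
                   (λ _ → subst (λ j → toℕ j < m) (splitAt⁻¹-↑ˡ eq) (↑ˡ-< a k))
... | inj₂ b = mk⇔ (λ i<m → contradiction (subst (λ j → m ≤ toℕ j) (splitAt⁻¹-↑ʳ eq) (↑ʳ-≥ m b)) (<⇒≱ i<m))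
                   (λ τb<m → contradiction (↑ʳ-≥ m (τ b)) (<⇒≱ τb<m))

reducible⇒splits : ∀ {h : Fin n → Fin n} → Reducible h →
                   ∃₂ λ m k → suc m + suc k ≡ n × Splits h (suc m)
reducible⇒splits (m , k , eq , σ , τ , h≗) =
  m , k , eq , Splits-resp-≗ h≗ (cast-splits eq (⊕-splits (σ ⟨$⟩ʳ_) (τ ⟨$⟩ʳ_)))

module Restriction {p q} {h : Fin (p + q) → Fin (p + q)} (s : Splits h p) where

  restrictˡ : Fin p → Fin p
  restrictˡ a = fromℕ< (Equivalence.to (s (a ↑ˡ q)) (↑ˡ-< a q))

  restrictʳ : Fin q → Fin q
  restrictʳ b = reduce≥ (h (p ↑ʳ b))
                        (≮⇒≥ (λ hb<p → <⇒≱ (Equivalence.from (s (p ↑ʳ b)) hb<p) (↑ʳ-≥ p b)))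

  restrictˡ-↑ˡ : ∀ a → restrictˡ a ↑ˡ q ≡ h (a ↑ˡ q)
  restrictˡ-↑ˡ a = splitAt⁻¹-↑ˡ (splitAt-< p (h (a ↑ˡ q)) _)

  restrictʳ-↑ʳ : ∀ b → p ↑ʳ restrictʳ b ≡ h (p ↑ʳ b)
  restrictʳ-↑ʳ b = splitAt⁻¹-↑ʳ (splitAt-≥ p (h (p ↑ʳ b)) _)

  ≗-restrictˡ⊕restrictʳ : h ≗ restrictˡ ⊕ restrictʳ
  ≗-restrictˡ⊕restrictʳ i with splitAt p i in eq
  ... | inj₁ a = trans (cong h (sym (splitAt⁻¹-↑ˡ eq))) (sym (restrictˡ-↑ˡ a))
  ... | inj₂ b = trans (cong h (sym (splitAt⁻¹-↑ʳ eq))) (sym (restrictʳ-↑ʳ b))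

open Restriction using (restrictˡ; restrictʳ; restrictˡ-↑ˡ; restrictʳ-↑ʳ; ≗-restrictˡ⊕restrictʳ)

module _ {p q} {g h : Fin (p + q) → Fin (p + q)}
         (sg : Splits g p) (sh : Splits h p) (hg : ∀ y → h (g y) ≡ y) where

  restrictˡ-inverse : ∀ a → restrictˡ sh (restrictˡ sg a) ≡ a
  restrictˡ-inverse a = ↑ˡ-injective q _ _ (begin
    restrictˡ sh (restrictˡ sg a) ↑ˡ q ≡⟨ restrictˡ-↑ˡ sh _ ⟩
    h (restrictˡ sg a ↑ˡ q)           ≡⟨ cong h (restrictˡ-↑ˡ sg a) ⟩
    h (g (a ↑ˡ q))                    ≡⟨ hg _ ⟩
    a ↑ˡ q                            ∎)
    where open ≡-Reasoning

  restrictʳ-inverse : ∀ b → restrictʳ sh (restrictʳ sg b) ≡ b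
  restrictʳ-inverse b = ↑ʳ-injective p _ _ (begin
    p ↑ʳ restrictʳ sh (restrictʳ sg b) ≡⟨ restrictʳ-↑ʳ sh _ ⟩
    h (p ↑ʳ restrictʳ sg b)            ≡⟨ cong h (restrictʳ-↑ʳ sg b) ⟩
    h (g (p ↑ʳ b))                     ≡⟨ hg _ ⟩
    p ↑ʳ b                             ∎)
    where open ≡-Reasoning

splits⇒reducible : ∀ {m k} (ρ : Permutation′ (suc m + suc k)) → Splits (ρ ⟨$⟩ʳ_) (suc m) →
                   Reducible (ρ ⟨$⟩ʳ_)
splits⇒reducible {m} {k} ρ s = m , k , refl , σ , τ , λ i → begin
  ρ ⟨$⟩ʳ i                                  ≡⟨ ≗-restrictˡ⊕restrictʳ s i ⟩
  (σ′ ⊕ τ′) i                               ≡⟨ cong (σ′ ⊕ τ′) (cast-is-id refl i) ⟨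
  (σ′ ⊕ τ′) (cast refl i)                   ≡⟨ cast-is-id refl _ ⟨
  cast refl ((σ′ ⊕ τ′) (cast refl i))       ∎
  where
  open ≡-Reasoning
  σ′ = restrictˡ s
  τ′ = restrictʳ s
  ρρ⁻¹ : ∀ y → ρ ⟨$⟩ʳ (ρ ⟨$⟩ˡ y) ≡ y
  ρρ⁻¹ _ = inverseʳ ρ
  ρ⁻¹ρ : ∀ x → ρ ⟨$⟩ˡ (ρ ⟨$⟩ʳ x) ≡ x
  ρ⁻¹ρ _ = inverseˡ ρ
  s⁻¹ : Splits (ρ ⟨$⟩ˡ_) (suc m)
  s⁻¹ = inverse-splits ρρ⁻¹ s
  σ : Permutation′ (suc m)
  σ = permutation σ′ (restrictˡ s⁻¹) (restrictˡ-inverse s⁻¹ s ρρ⁻¹) (restrictˡ-inverse s s⁻¹ ρ⁻¹ρ)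
  τ : Permutation′ (suc k)
  τ = permutation τ′ (restrictʳ s⁻¹) (restrictʳ-inverse s⁻¹ s ρρ⁻¹) (restrictʳ-inverse s s⁻¹ ρ⁻¹ρ)

-- Orbits and cycle leaders

module _ {f : A → A} where

  iterate-+ : ∀ x a b → iterate f x (a + b) ≡ iterate f (iterate f x a) b
  iterate-+ x zero    b = refl
  iterate-+ x (suc a) b = iterate-+ (f x) a b

  iterate-suc : ∀ x t → iterate f x (suc t) ≡ f (iterate f x t)
  iterate-suc x zero    = refl
  iterate-suc x (suc t) = iterate-suc (f x) t

  iterate-injective : Injective _≡_ _≡_ f → ∀ t → Injective _≡_ _≡_ (λ x → iterate f x t)
  iterate-injective _     zero    eq = eq
  iterate-injective f-inj (suc t) eq = f-inj (iterate-injective f-inj t eq)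

  iterate-collision : Injective _≡_ _≡_ f → ∀ {x a b} → a < b → iterate f x a ≡ iterate f x b →
                      iterate f (f x) (b ∸ suc a) ≡ x
  iterate-collision f-inj {x} {a} {b} a<b eq = iterate-injective f-inj a (begin
    iterate f (iterate f x (suc d)) a ≡⟨ iterate-+ x (suc d) a ⟨
    iterate f x (suc d + a)           ≡⟨ cong (iterate f x) (trans (sym (+-suc d a)) (m∸n+n≡m a<b)) ⟩
    iterate f x b                     ≡⟨ eq ⟨
    iterate f x a                     ∎)
    where
    open ≡-Reasoning
    d = b ∸ suc a

cycleFrom≡applyUpTo : ∀ (f : Fin n → Fin n) {m x} k {fuel} → iterate f x k ≡ m →
                      (∀ {t} → t < k → iterate f x t ≢ m) → k ≤ fuel →
                      cycleFrom f m x fuel ≡ applyUpTo (iterate f x) k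
cycleFrom≡applyUpTo f         zero {zero}   refl _ _ = refl
cycleFrom≡applyUpTo f {x = x} zero {suc _}  refl _ _ with x Fin.≟ x
... | yes _   = refl
... | no x≢x = contradiction refl x≢x
cycleFrom≡applyUpTo f {m} {x} (suc k) {suc _} hit before (s≤s k≤fuel) with x Fin.≟ m
... | yes x≡m = contradiction x≡m (before z<s)
... | no _    = cong (x ∷_) (cycleFrom≡applyUpTo f k hit (before ∘ s<s) k≤fuel)

module Orbits {n} (f : Fin n → Fin n) (f-injective : Injective _≡_ _≡_ f) where

  open import Data.List.Extrema (≤-totalOrder n) using (max; argmax-all; xs≤max)

  private
    returns-within-n : ∀ x → ∃ λ t → t < n × iterate f (f x) t ≡ x
    returns-within-n x with pigeonhole (n<1+n n) (λ (j : Fin (suc n)) → iterate f x (toℕ j))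
    ... | a , b , a<b , eq =
      toℕ b ∸ suc (toℕ a) , <-≤-trans (∸-monoʳ-< z<s a<b) (≤-pred (toℕ<n b)) ,
      iterate-collision f-injective a<b eq

    first-return : ∀ x → ∃ λ (r : Fin n) →
                   iterate f (f x) (toℕ r) ≡ x × (∀ {t} → t < toℕ r → iterate f (f x) t ≢ x)
    first-return x with ¬∀⟶∃¬-smallest n _ (λ r → ¬? (iterate f (f x) (toℕ r) Fin.≟ x)) never-returns
      where
      never-returns : ¬ (∀ (r : Fin n) → iterate f (f x) (toℕ r) ≢ x)
      never-returns ∀≢ with returns-within-n x
      ... | t , t<n , hit =
        ∀≢ (fromℕ< t<n) (subst (λ s → iterate f (f x) s ≡ x) (sym (toℕ-fromℕ< t<n)) hit)
    ... | r , ¬≢ , earlier = r , decidable-stable (_ Fin.≟ x) ¬≢ , λ {t} t<r →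
      subst (λ s → iterate f (f x) s ≢ x) (trans (toℕ-inject (fromℕ< t<r)) (toℕ-fromℕ< t<r))
            (earlier (fromℕ< t<r))

  returnTime : Fin n → ℕ
  returnTime x = toℕ (proj₁ (first-return x))

  iterate-returnTime : ∀ x → iterate f (f x) (returnTime x) ≡ x
  iterate-returnTime x = proj₁ (proj₂ (first-return x))

  returnTime-minimal : ∀ x {t} → t < returnTime x → iterate f (f x) t ≢ x
  returnTime-minimal x = proj₂ (proj₂ (first-return x))

  orbit≡applyUpTo : ∀ x → orbit f x ≡ applyUpTo (iterate f x) (suc (returnTime x))
  orbit≡applyUpTo x = cong (x ∷_) (cycleFrom≡applyUpTo f (returnTime x)
    (iterate-returnTime x) (returnTime-minimal x) (<⇒≤ (toℕ<n _)))

  _∼_ : Fin n → Fin n → Set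
  x ∼ y = ∃ λ t → iterate f x t ≡ y

  ∼-refl : ∀ {x} → x ∼ x
  ∼-refl = 0 , refl

  ∼-step : ∀ {x} → x ∼ f x
  ∼-step = 1 , refl

  ∼-trans : ∀ {x y z} → x ∼ y → y ∼ z → x ∼ z
  ∼-trans {x} (a , refl) (b , refl) = a + b , iterate-+ x a b

  ∼-sym : ∀ {x y} → x ∼ y → y ∼ x
  ∼-sym         (zero  , refl) = ∼-refl
  ∼-sym {x = x} (suc t , refl) = ∼-trans (∼-sym {f x} (t , refl)) (returnTime x , iterate-returnTime x)

  ∈-orbit⁻ : ∀ {x y} → y ∈ orbit f x → ∃ λ i → i < suc (returnTime x) × y ≡ iterate f x i
  ∈-orbit⁻ {x} {y} = ∈-applyUpTo⁻ (iterate f x) ∘ subst (y ∈_) (orbit≡applyUpTo x)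

  orbit-closed : ∀ {x y} → y ∈ orbit f x → f y ∈ orbit f x
  orbit-closed {x} y∈ with ∈-orbit⁻ y∈
  ... | i , i<period , refl with m≤n⇒m<n∨m≡n i<period
  ... | inj₁ 1+i<period = subst (_∈ orbit f x) (iterate-suc x i)
    (subst (iterate f x (suc i) ∈_) (sym (orbit≡applyUpTo x)) (∈-applyUpTo⁺ (iterate f x) 1+i<period))
  ... | inj₂ refl = subst (_∈ orbit f x) (trans (sym (iterate-returnTime x)) (iterate-suc x i)) (here refl)

  ∈-orbit⇔ : ∀ {x y} → y ∈ orbit f x ⇔ x ∼ y
  ∈-orbit⇔ {x} = mk⇔ to (λ { (t , refl) → iterate∈ t })
    where
    to : ∀ {y} → y ∈ orbit f x → x ∼ y
    to y∈ with ∈-orbit⁻ y∈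
    ... | i , _ , y≡ = i , sym y≡
    iterate∈ : ∀ t → iterate f x t ∈ orbit f x
    iterate∈ zero    = here refl
    iterate∈ (suc t) = subst (_∈ orbit f x) (sym (iterate-suc x t)) (orbit-closed (iterate∈ t))

  orbit-unique : ∀ x → Unique (orbit f x)
  orbit-unique x = subst Unique (sym (orbit≡applyUpTo x)) (applyUpTo⁺₁ (iterate f x) _ distinct)
    where
    distinct : ∀ {a b} → a < b → b < suc (returnTime x) → iterate f x a ≢ iterate f x b
    distinct {a} {b} a<b b≤r eq =
      returnTime-minimal x (<-≤-trans (∸-monoʳ-< z<s a<b) (≤-pred b≤r)) (iterate-collision f-injective a<b eq)

  -- isLeader runs its test through a where-bound helper of Defs that cannot be named here;
  -- leaderTest is a hole that unification fills with that helper once the orbit's tail is a variable.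
  mutual
    private
      leaderTest : Fin n → List (Fin n) → Bool
      leaderTest = _

    isLeader⇔ : ∀ m → isLeader f m ≡ true ⇔ All (λ y → toℕ y ≤ toℕ m) (orbit f m)
    isLeader⇔ m with cycleFrom f m (f m) n
    ... | ys = if-∷≡true⇔All (λ y → toℕ y ≤? toℕ m)
                 (fold-if≡true⇔All (λ y → toℕ y ≤? toℕ m) {leaderTest m} refl (λ _ _ → refl) ys)

  leader : Fin n → Fin n
  leader x = max x (orbit f x)

  leader-∈ : ∀ x → leader x ∈ orbit f x
  leader-∈ x = argmax-all id (here refl) (All.tabulate id)

  ∼-leader : ∀ {x} → x ∼ leader x
  ∼-leader = Equivalence.to ∈-orbit⇔ (leader-∈ _)

  leader-maximal : ∀ {x y} → leader x ∼ y → toℕ y ≤ toℕ (leader x)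
  leader-maximal {x} l∼y =
    All.lookup (xs≤max x (orbit f x)) (Equivalence.from ∈-orbit⇔ (∼-trans ∼-leader l∼y))

  ≤-leader : ∀ x → toℕ x ≤ toℕ (leader x)
  ≤-leader x = leader-maximal (∼-sym ∼-leader)

  isLeader-leader : ∀ x → isLeader f (leader x) ≡ true
  isLeader-leader x = Equivalence.from (isLeader⇔ _) (All.tabulate (leader-maximal ∘ Equivalence.to ∈-orbit⇔))

  isLeader⇒≡leader : ∀ {m y} → isLeader f m ≡ true → m ∼ y → m ≡ leader y
  isLeader⇒≡leader {m} isL m∼y = toℕ-injective (≤-antisym
    (leader-maximal (∼-trans (∼-sym ∼-leader) (∼-sym m∼y)))
    (All.lookup (Equivalence.to (isLeader⇔ m) isL) (Equivalence.from ∈-orbit⇔ (∼-trans m∼y ∼-leader))))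

  leader-step : ∀ x → leader (f x) ≡ leader x
  leader-step x = sym (isLeader⇒≡leader (isLeader-leader x) (∼-trans (∼-sym ∼-leader) ∼-step))

  splits-∼ : ∀ {p x y} → Splits f p → x ∼ y → toℕ x < p ⇔ toℕ y < p
  splits-∼         s (zero  , refl) = ⇔-id _
  splits-∼ {x = x} s (suc t , refl) = ⇔-trans (s x) (splits-∼ s (t , refl))

  splits⇔leader-splits : ∀ {p} → Splits f p ⇔ Splits leader p
  splits⇔leader-splits {p} = mk⇔ (λ s x → splits-∼ s ∼-leader) from
    where
    from : Splits leader p → Splits f p
    from s x = ⇔-trans (s x) (subst (λ l → toℕ l < p ⇔ toℕ (f x) < p) (leader-step x) (⇔-sym (s (f x))))

  -- thetaWord f is concatMap block (allFin n) by definition.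
  block : Fin n → List (Fin n)
  block m = if isLeader f m then orbit f m else []

  block-leader : ∀ x → block (leader x) ≡ orbit f (leader x)
  block-leader x = cong (if_then orbit f (leader x) else []) (isLeader-leader x)

  ∈-block⇔ : ∀ {m y} → y ∈ block m ⇔ leader y ≡ m
  ∈-block⇔ {m} {y} = mk⇔ to λ { refl →
    subst (y ∈_) (sym (block-leader y)) (Equivalence.from ∈-orbit⇔ (∼-sym ∼-leader)) }
    where
    to : y ∈ block m → leader y ≡ m
    to y∈ with isLeader f m in isL
    to y∈ | true = sym (isLeader⇒≡leader isL (Equivalence.to ∈-orbit⇔ y∈))
    to () | false

  block-unique : ∀ m → Unique (block m)
  block-unique m with isLeader f m
  ... | true  = orbit-unique m
  ... | false = []

  ∈-concatMap-block⇔ : ∀ {ms y} → y ∈ concatMap block ms ⇔ leader y ∈ ms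
  ∈-concatMap-block⇔ = mk⇔ (Any.map (Equivalence.to ∈-block⇔) ∘ ∈-concatMap⁻ block)
                           (∈-concatMap⁺ block ∘ Any.map (Equivalence.from ∈-block⇔))

  concatMap-block-unique : ∀ {ms} → Unique ms → Unique (concatMap block ms)
  concatMap-block-unique uniq =
    concat⁺ (All.map⁺ (All.tabulate λ {m} _ → block-unique m)) (AllPairs.map⁺ (AllPairs.map disjoint uniq))
    where
    disjoint : ∀ {m m′} → m ≢ m′ → Disjoint (block m) (block m′)
    disjoint m≢m′ (y∈ , y∈′) =
      m≢m′ (trans (sym (Equivalence.to ∈-block⇔ y∈)) (Equivalence.to ∈-block⇔ y∈′))

  ∈-thetaWord : ∀ y → y ∈ thetaWord f
  ∈-thetaWord y = Equivalence.from ∈-concatMap-block⇔ (∈-allFin (leader y))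

  thetaWord-unique : Unique (thetaWord f)
  thetaWord-unique = concatMap-block-unique (allFin⁺ n)

  length-thetaWord : length (thetaWord f) ≡ n
  length-thetaWord =
    length-unique-below ≤-refl thetaWord-unique (λ y → mk⇔ (λ _ → toℕ<n y) (λ _ → ∈-thetaWord y))

-- The fundamental bijection

module Theta {n} (π : Permutation′ n) where

  open Orbits (π ⟨$⟩ʳ_) (Injection.injective (↔⇒↣ π)) public

  θ-fromℕ< : ∀ {k} (k<n : k < n) → θ π (fromℕ< k<n) ≡ nth (fromℕ< k<n) (thetaWord (π ⟨$⟩ʳ_)) k
  θ-fromℕ< k<n = cong (nth (fromℕ< k<n) (thetaWord (π ⟨$⟩ʳ_))) (toℕ-fromℕ< k<n)

  θ-injective : Injective _≡_ _≡_ (θ π)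
  θ-injective {i} {j} eq = toℕ-injective (nth-injective thetaWord-unique (bound i) (bound j) eq)
    where
    bound : ∀ k → toℕ k < length (thetaWord (π ⟨$⟩ʳ_))
    bound k = subst (toℕ k <_) (sym length-thetaWord) (toℕ<n k)

  private
    index<n : ∀ y → toℕ (index (∈-thetaWord y)) < n
    index<n y = subst (toℕ (index (∈-thetaWord y)) <_) length-thetaWord (toℕ<n _)

  θ⁻¹ : Fin n → Fin n
  θ⁻¹ y = fromℕ< (index<n y)

  θ-θ⁻¹ : ∀ y → θ π (θ⁻¹ y) ≡ y
  θ-θ⁻¹ y = trans (θ-fromℕ< (index<n y)) (nth-index (θ⁻¹ y) (∈-thetaWord y))

  θ↔ : Permutation′ n
  θ↔ = permutation (θ π) θ⁻¹ θ-θ⁻¹ (λ x → θ-injective (θ-θ⁻¹ (θ π x)))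

  leader-precedes : ∀ y → ∃₂ λ i j → toℕ i ≤ toℕ j × θ π i ≡ leader y × θ π j ≡ y
  leader-precedes y with ∈-∃++ (∈-allFin (leader y))
  ... | as , bs , allFin≡ =
    let i , i≡ , θi = at 0 (s≤s z≤n)
        j , j≡ , θj = at (toℕ (index y∈O)) (toℕ<n _)
    in  i , j , subst₂ _≤_ (sym i≡) (sym j≡) (+-monoʳ-≤ _ z≤n) , θi , trans θj (nth-index j y∈O)
    where
    O  = orbit (π ⟨$⟩ʳ_) (leader y)
    WA = concatMap block as
    WB = concatMap block bs
    y∈O : y ∈ O
    y∈O = Equivalence.from ∈-orbit⇔ (∼-sym ∼-leader)

    thetaWord≡ : thetaWord (π ⟨$⟩ʳ_) ≡ WA ++ (O ++ WB)
    thetaWord≡ = begin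
      concatMap block (allFin n)                ≡⟨ cong (concatMap block) allFin≡ ⟩
      concatMap block (as ++ leader y ∷ bs)     ≡⟨ concatMap-++ block as _ ⟩
      WA ++ (block (leader y) ++ WB)            ≡⟨ cong (λ b → WA ++ (b ++ WB)) (block-leader y) ⟩
      WA ++ (O ++ WB)                           ∎
      where open ≡-Reasoning

    at : ∀ j → j < length O → ∃ λ i → toℕ i ≡ length WA + j × θ π i ≡ nth i O j
    at j j<O = i , toℕ-fromℕ< k<n , (begin
      θ π i                                          ≡⟨ θ-fromℕ< k<n ⟩
      nth i (thetaWord (π ⟨$⟩ʳ_)) (length WA + j)    ≡⟨ cong (λ w → nth i w (length WA + j)) thetaWord≡ ⟩
      nth i (WA ++ (O ++ WB)) (length WA + j)        ≡⟨ nth-++ʳ i WA (O ++ WB) j ⟩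
      nth i (O ++ WB) j                              ≡⟨ nth-++ˡ i O WB j<O ⟩
      nth i O j                                      ∎)
      where
      open ≡-Reasoning
      k<n : length WA + j < n
      k<n = subst (length WA + j <_)
                  (trans (sym (length-++ WA)) (trans (cong length (sym thetaWord≡)) length-thetaWord))
                  (+-monoʳ-< (length WA) (<-≤-trans j<O (length-++-≤ˡ O)))
      i = fromℕ< k<n

  θ-splits⇒leader-splits : ∀ {p} → Splits (θ π) p → Splits leader p
  θ-splits⇒leader-splits {p} s y = mk⇔ to (≤-<-trans (≤-leader y))
    where
    to : toℕ y < p → toℕ (leader y) < p
    to y<p =
      let i , j , i≤j , θi≡ , θj≡ = leader-precedes y
          j<p = Equivalence.from (s j) (subst (λ z → toℕ z < p) (sym θj≡) y<p)
      in  subst (λ z → toℕ z < p) θi≡ (Equivalence.to (s i) (≤-<-trans i≤j j<p))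

module _ {p q} (π : Permutation′ (p + q)) where

  open Theta π

  leader-splits⇒θ-splits : Splits leader p → Splits (θ π) p
  leader-splits⇒θ-splits s =
    Splits-resp-≗ (λ i → cong (λ w → nth i w (toℕ i)) thetaWord≡)
                  (prefix-splits WA WB length-WA WA<p WB≥p)
    where
    WA = concatMap block (tabulate (_↑ˡ q))
    WB = concatMap block (tabulate (p ↑ʳ_))

    thetaWord≡ : thetaWord (π ⟨$⟩ʳ_) ≡ WA ++ WB
    thetaWord≡ = trans (cong (concatMap block) (tabulate-+ {p = p} {q} id))
                       (concatMap-++ block (tabulate (_↑ˡ q)) _)

    ∈WA⇔ : ∀ y → y ∈ WA ⇔ toℕ y < p
    ∈WA⇔ y = ⇔-trans ∈-concatMap-block⇔ (⇔-trans ∈-tabulate-↑ˡ⇔ (⇔-sym (s y)))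

    WA<p : All (λ y → toℕ y < p) WA
    WA<p = All.tabulate (Equivalence.to (∈WA⇔ _))

    WB≥p : All (λ y → p ≤ toℕ y) WB
    WB≥p = All.tabulate λ {y} y∈ →
      ≮⇒≥ λ y<p → <⇒≱ (Equivalence.to (s y) y<p)
                      (∈-tabulate-↑ʳ⇒≥ (Equivalence.to ∈-concatMap-block⇔ y∈))

    length-WA : length WA ≡ p
    length-WA = length-unique-below (m≤m+n p q)
                  (concatMap-block-unique (tabulate⁺ (↑ˡ-injective q _ _))) ∈WA⇔

  splits⇔θ-splits : Splits (π ⟨$⟩ʳ_) p ⇔ Splits (θ π) p
  splits⇔θ-splits = ⇔-trans splits⇔leader-splits (mk⇔ leader-splits⇒θ-splits θ-splits⇒leader-splits)

reducible⇒θ-reducible : ∀ {n} (π : Permutation′ n) → Reducible (π ⟨$⟩ʳ_) → Reducible (θ π)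
reducible⇒θ-reducible π r with reducible⇒splits r
... | m , k , refl , s = splits⇒reducible (Theta.θ↔ π) (Equivalence.to (splits⇔θ-splits π) s)

θ-reducible⇒reducible : ∀ {n} (π : Permutation′ n) → Reducible (θ π) → Reducible (π ⟨$⟩ʳ_)
θ-reducible⇒reducible π r with reducible⇒splits r
... | m , k , refl , s = splits⇒reducible π (Equivalence.from (splits⇔θ-splits π) s)

proposition2p2 : (n : ℕ) (π : Permutation′ n) →
    Irreducible (π ⟨$⟩ʳ_) ⇔ Irreducible (θ π)
proposition2p2 n π =
  mk⇔ (contraposition (θ-reducible⇒reducible π)) (contraposition (reducible⇒θ-reducible π))
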